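{- There are infinitely many positive integers $N$ that cannot be written as $N = A/B$ with $A, B$ antipalindromic numbers.
   Context: A positive integer is antipalindromic if its base-$2$ representation (without leading zeros) $w_1 \cdots w_{2m}$ has even length and satisfies $w_i + w_{2m+1-i} = 1$ for all $i$ (the second half is the reverse complement of the first half). -}

module Defs where

open import Data.Nat using (ℕ; zero; suc; _+_; _*_; _<_; _/_; _%_)
open import Data.List using (List; []; _∷_; length; reverse; lookup)
open import Data.Fin using (Fin; toℕ)
open import Data.Product using (Σ; ∃; _×_; _,_)
open import Relation.Binary.PropositionalEquality using (_≡_)

-- Binary digits of n, least significant first, computed with fuel.
-- With fuel ≥ n this yields the full representation without leading zeros
-- (and [] for n = 0).
bitsLSB-fuel : ℕ → ℕ → List ℕ
bitsLSB-fuel zero    n       = []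
bitsLSB-fuel (suc f) zero    = []
bitsLSB-fuel (suc f) (suc n) = (suc n % 2) ∷ bitsLSB-fuel f (suc n / 2)

binary : ℕ → List ℕ
binary n = reverse (bitsLSB-fuel n n)

-- The word w₁ ⋯ w₂ₘ has even length 2m and w_i + w_{2m+1-i} = 1 for all i.
-- With 0-based index j = i - 1, the partner index is 2m - 1 - j.
AntipalindromicWord : List ℕ → Set
AntipalindromicWord w =
  (Σ ℕ λ m → length w ≡ m + m) ×
  ((i i' : Fin (length w)) → toℕ i + toℕ i' + 1 ≡ length w →
     lookup w i + lookup w i' ≡ 1)

Antipalindromic : ℕ → Set
Antipalindromic n = (0 < n) × AntipalindromicWord (binary n)

-- Doubling a positive number appends one binary digit, so multiplying by 2 ^ j
-- adds exactly j digits. Antipalindromic numbers have an even number of digits,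
-- hence the quotient of two of them is never an odd power of two; the powers
-- 2 ^ (2k+1) are infinitely many such N.
module Submission where

open import Defs
open import Data.Nat using (ℕ; zero; suc; _+_; _*_; _^_; _<_; _≤_; _/_; _%_; z≤n; s≤s; NonZero; >-nonZero)
open import Data.Nat.Properties
open import Data.Nat.DivMod using (m/n<m; m*n/n≡m)
open import Data.List using (_∷_; length)
open import Data.List.Properties using (length-reverse)
open import Data.Product using (Σ; _×_; _,_)
open import Relation.Binary.PropositionalEquality using (_≡_; _≢_; refl; sym; trans; cong; module ≡-Reasoning)
open import Relation.Nullary using (¬_)
open import Function using (_∘_)

bitsLSB-fuel-irrelevant : ∀ {f g} n → n ≤ f → n ≤ g → bitsLSB-fuel f n ≡ bitsLSB-fuel g n
bitsLSB-fuel-irrelevant {zero}  {zero}  zero    _       _       = refl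
bitsLSB-fuel-irrelevant {zero}  {suc g} zero    _       _       = refl
bitsLSB-fuel-irrelevant {suc f} {zero}  zero    _       _       = refl
bitsLSB-fuel-irrelevant {suc f} {suc g} zero    _       _       = refl
bitsLSB-fuel-irrelevant {suc f} {suc g} (suc n) (s≤s n≤f) (s≤s n≤g) =
  cong (suc n % 2 ∷_) (bitsLSB-fuel-irrelevant (suc n / 2) (≤-trans half≤n n≤f) (≤-trans half≤n n≤g))
  where
  half≤n : suc n / 2 ≤ n
  half≤n = ≤-pred (m/n<m (suc n) 2 (s≤s (s≤s z≤n)))

length-bitsLSB-double : ∀ n .{{_ : NonZero n}} →
                 length (bitsLSB-fuel (2 * n) (2 * n)) ≡ suc (length (bitsLSB-fuel n n))
length-bitsLSB-double n@(suc n-1) = cong (suc ∘ length) (begin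
  bitsLSB-fuel (n-1 + 1 * n) (2 * n / 2) ≡⟨ cong (bitsLSB-fuel _) (trans (cong (_/ 2) (*-comm 2 n)) (m*n/n≡m n 2)) ⟩
  bitsLSB-fuel (n-1 + 1 * n) n           ≡⟨ bitsLSB-fuel-irrelevant n (≤-trans (m≤n*m n 1) (m≤n+m (1 * n) n-1)) ≤-refl ⟩
  bitsLSB-fuel n n                       ∎)
  where open ≡-Reasoning

bitLength : ℕ → ℕ
bitLength n = length (binary n)

bitLength-double : ∀ n .{{_ : NonZero n}} → bitLength (2 * n) ≡ suc (bitLength n)
bitLength-double n = begin
  length (binary (2 * n))                  ≡⟨ length-reverse (bitsLSB-fuel (2 * n) (2 * n)) ⟩
  length (bitsLSB-fuel (2 * n) (2 * n))    ≡⟨ length-bitsLSB-double n ⟩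
  suc (length (bitsLSB-fuel n n))          ≡⟨ cong suc (sym (length-reverse (bitsLSB-fuel n n))) ⟩
  suc (length (binary n))                  ∎
  where open ≡-Reasoning

bitLength-2^* : ∀ j n .{{_ : NonZero n}} → bitLength (2 ^ j * n) ≡ j + bitLength n
bitLength-2^* zero    n = cong bitLength (*-identityˡ n)
bitLength-2^* (suc j) n = begin
  bitLength (2 * 2 ^ j * n)     ≡⟨ cong bitLength (*-assoc 2 (2 ^ j) n) ⟩
  bitLength (2 * (2 ^ j * n))   ≡⟨ bitLength-double (2 ^ j * n) {{m*n≢0 (2 ^ j) n {{m^n≢0 2 j}}}} ⟩
  suc (bitLength (2 ^ j * n))   ≡⟨ cong suc (bitLength-2^* j n) ⟩
  suc (j + bitLength n)         ∎
  where open ≡-Reasoning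

antipalindromic⇒even-bitLength : ∀ {n} → Antipalindromic n → Σ ℕ λ m → bitLength n ≡ 2 * m
antipalindromic⇒even-bitLength (_ , (m , len≡m+m) , _) =
  m , trans len≡m+m (cong (m +_) (sym (+-identityʳ m)))

antipalindromic-ratio≢2^odd : ∀ {A B} k → Antipalindromic A → Antipalindromic B →
                              A ≢ 2 ^ suc (2 * k) * B
antipalindromic-ratio≢2^odd {A} {B} k apA apB@(0<B , _) A≡
  with antipalindromic⇒even-bitLength apA | antipalindromic⇒even-bitLength apB
... | a , lenA | b , lenB = even≢odd a (k + b) (begin
  2 * a                            ≡⟨ sym lenA ⟩
  bitLength A                      ≡⟨ cong bitLength A≡ ⟩
  bitLength (2 ^ suc (2 * k) * B)  ≡⟨ bitLength-2^* (suc (2 * k)) B {{>-nonZero 0<B}} ⟩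
  suc (2 * k + bitLength B)        ≡⟨ cong (λ l → suc (2 * k + l)) lenB ⟩
  suc (2 * k + 2 * b)              ≡⟨ cong suc (sym (*-distribˡ-+ 2 k b)) ⟩
  suc (2 * (k + b))                ∎)
  where open ≡-Reasoning

n<2^n : ∀ n → n < 2 ^ n
n<2^n zero    = s≤s z≤n
n<2^n (suc n) = begin-strict
  suc n          ≡⟨ +-comm 1 n ⟩
  n + 1          <⟨ +-mono-<-≤ (n<2^n n) (m^n>0 2 n) ⟩
  2 ^ n + 2 ^ n  ≡⟨ cong (2 ^ n +_) (sym (+-identityʳ (2 ^ n))) ⟩
  2 * 2 ^ n      ∎
  where open ≤-Reasoning

theorem17 : (k : ℕ) → Σ ℕ λ N → (k < N) ×
              ¬ (Σ ℕ λ A → Σ ℕ λ B →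
                   Antipalindromic A × Antipalindromic B × (A ≡ N * B))
theorem17 k =
  2 ^ suc (2 * k) ,
  ≤-<-trans (m≤n⇒m≤1+n (m≤m+n k (k + 0))) (n<2^n (suc (2 * k))) ,
  λ (A , B , apA , apB , A≡) → antipalindromic-ratio≢2^odd k apA apB A≡
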